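{- Let $k\ge 2$, let $G$ be a graph with a closed neighborhood balanced $k$-coloring $c$, and let $z\in V(G)$ with $c(z)=k$. Let $G'$ be the graph obtained from $G$ by a $(3k-2)$-vertex addition at $z$, and let $c'$ be the coloring of $G'$ that extends $c$ by the colors prescribed in that construction. Then $c'$ is a closed neighborhood balanced $k$-coloring of $G'$, and compared with $c$, the coloring $c'$ has exactly one additional vertex of color $k$ (the color of $z$) and exactly three additional vertices of each of the other $k-1$ colors.
   Context: All graphs are finite and simple; $N[v]$ is the closed neighborhood of $v$. A closed neighborhood balanced $k$-coloring of $G$ is a map $c:V(G)\to\{1,\dots,k\}$ such that for every vertex $v$ the numbers $|N[v]\cap c^{ -1}(i)|$, $i=1,\dots,k$, are all equal. Given such a coloring of $G$ and a vertex $z$ of color $k$, a $(3k-2)$-vertex addition at $z$ is defined as follows: add new vertices $u_1,\dots,u_k$, each adjacent to $z$, and for every $1\le i\le k-1$ make $u_i$ adjacent to $u_{i+1},\dots,u_{k-1}$ (so $u_1,\dots,u_{k-1}$ form a clique). Add new vertices $v_1,\dots,v_{k-1}$ and $v_1',\dots,v_{k-1}'$, all adjacent to $u_k$; for each $1\le i\le k-2$, make $v_i$ adjacent to $v_{i+1},\dots,v_{k-1}$ and $v_i'$ adjacent to $v_{i+1}',\dots,v_{k-1}'$. No other edges are added. Colors: $u_i$ gets color $i$ for $1\le i\le k$, and $v_i$, $v_i'$ both get color $i$ for $1\le i\le k-1$. -}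

module Defs where

open import Data.Nat using (ℕ; zero; suc; _+_)
open import Data.Bool using (Bool; true; false; if_then_else_; _∨_; _∧_; not)
open import Data.Fin using (Fin; zero; suc; splitAt; inject₁; fromℕ; _≟_)
open import Data.Sum using (_⊎_; inj₁; inj₂)
open import Relation.Nullary using (does)
open import Relation.Binary.PropositionalEquality using (_≡_)

_==_ : ∀ {n} → Fin n → Fin n → Bool
i == j = does (i ≟ j)

record Graph (n : ℕ) : Set where
  field
    adj   : Fin n → Fin n → Bool
    sym   : ∀ u v → adj u v ≡ adj v u
    irrefl : ∀ v → adj v v ≡ false
open Graph public

count : ∀ {n} → (Fin n → Bool) → ℕ
count {zero}  p = 0
count {suc n} p = (if p zero then 1 else 0) + count (λ x → p (suc x))

inN : ∀ {n} → (Fin n → Fin n → Bool) → Fin n → Fin n → Bool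
inN adj v w = (v == w) ∨ adj v w

nbColorCount : ∀ {n k} → (Fin n → Fin n → Bool) → (Fin n → Fin k) → Fin n → Fin k → ℕ
nbColorCount adj c v i = count (λ w → inN adj v w ∧ (c w == i))

-- closed neighbourhood balanced k-coloring (colors are Fin k, i.e. 0..k-1
-- standing for 1..k), phrased for an adjacency relation
IsCNBalanced : ∀ {n k} → (Fin n → Fin n → Bool) → (Fin n → Fin k) → Set
IsCNBalanced adj c = ∀ v i j → nbColorCount adj c v i ≡ nbColorCount adj c v j

colorCount : ∀ {n k} → (Fin n → Fin k) → Fin k → ℕ
colorCount c i = count (λ w → c w == i)

-- (3k-2)-vertex addition, with k = suc m.
-- New vertices: u_i (i : Fin (suc m), 0-based index of u_1..u_k),
-- v_i and v'_i (i : Fin m, 0-based index of v_1..v_{k-1}).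
-- G' has vertex set Fin (n + (suc m + (m + m))): first the old vertices.

data Kind (n m : ℕ) : Set where
  old : Fin n → Kind n m
  uu  : Fin (suc m) → Kind n m
  vv  : Fin m → Kind n m
  vv' : Fin m → Kind n m

NewSize : ℕ → ℕ
NewSize m = suc m + (m + m)

classify : ∀ n m → Fin (n + NewSize m) → Kind n m
classify n m x with splitAt n x
... | inj₁ a = old a
... | inj₂ y with splitAt (suc m) y
...   | inj₁ i = uu i
...   | inj₂ w with splitAt m w
...     | inj₁ i = vv i
...     | inj₂ i = vv' i

isTop : ∀ {m} → Fin (suc m) → Bool
isTop {m} i = i == fromℕ m

kindAdj : ∀ {n m} → (Fin n → Fin n → Bool) → Fin n → Kind n m → Kind n m → Bool
kindAdj a z (old x) (old y) = a x y
kindAdj a z (old x) (uu i)  = x == z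
kindAdj a z (uu i)  (old x) = x == z
kindAdj a z (old x) (vv i)  = false
kindAdj a z (old x) (vv' i) = false
kindAdj a z (vv i)  (old x) = false
kindAdj a z (vv' i) (old x) = false
kindAdj a z (uu i)  (uu j)  = not (i == j) ∧ (not (isTop i) ∧ not (isTop j))
kindAdj a z (uu i)  (vv j)  = isTop i
kindAdj a z (uu i)  (vv' j) = isTop i
kindAdj a z (vv j)  (uu i)  = isTop i
kindAdj a z (vv' j) (uu i)  = isTop i
kindAdj a z (vv i)  (vv j)  = not (i == j)
kindAdj a z (vv' i) (vv' j) = not (i == j)
kindAdj a z (vv i)  (vv' j) = false
kindAdj a z (vv' i) (vv j)  = false

addAdj : ∀ {n} m → (Fin n → Fin n → Bool) → Fin n → Fin (n + NewSize m) → Fin (n + NewSize m) → Bool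
addAdj {n} m a z x y = kindAdj a z (classify n m x) (classify n m y)

kindColor : ∀ {n m} → (Fin n → Fin (suc m)) → Kind n m → Fin (suc m)
kindColor c (old x) = c x
kindColor c (uu i)  = i
kindColor c (vv i)  = inject₁ i
kindColor c (vv' i) = inject₁ i

addColor : ∀ {n} m → (Fin n → Fin (suc m)) → Fin (n + NewSize m) → Fin (suc m)
addColor {n} m c x = kindColor c (classify n m x)

-- An old vertex
-- keeps its neighbourhood in G, and z additionally sees u₁, …, u_k, one vertex of
-- each colour. A vertex u_i with i < k sees z (colour k) and the clique
-- u₁, …, u_{k-1}: each colour once. The vertex u_k sees z, itself and both cliques
-- v and v′: each colour twice. A vertex v_i or v′_i sees u_k (colour k) and its own
-- clique: each colour once. The new vertices contribute one vertex of colour k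
-- and three (u_i, v_i, v′_i) of every other colour i.

module Submission where

open import Defs hiding (sym)
open import Data.Nat using (ℕ; zero; suc; _+_; _≤_)
open import Data.Nat.Properties using (+-assoc; +-identityʳ; suc-injective)
open import Data.Fin using (Fin; zero; suc; fromℕ; inject₁; splitAt; _↑ˡ_; _↑ʳ_; _≟_)
import Data.Fin.Properties as Finₚ
open import Data.Fin.Properties using (splitAt-↑ˡ; splitAt-↑ʳ; splitAt⁻¹-↑ˡ; splitAt⁻¹-↑ʳ)
open import Data.Bool using (Bool; true; false; if_then_else_; _∨_; _∧_; not)
open import Data.Bool.Properties using (∧-zeroʳ; ∧-identityʳ; ∨-identityʳ; ∨-inverseʳ)
open import Data.Product using (_×_; _,_)
open import Data.Sum using (inj₁; inj₂)
open import Relation.Nullary using (Dec; yes; no)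
open import Relation.Nullary.Decidable using (dec-true; dec-false)
open import Relation.Binary.PropositionalEquality
  using (_≡_; _≢_; refl; sym; trans; cong; cong₂; subst; module ≡-Reasoning)

⟦_⟧ : Bool → ℕ
⟦ b ⟧ = if b then 1 else 0

⟦b⟧+⟦not-b⟧≡1 : ∀ b → ⟦ b ⟧ + ⟦ not b ⟧ ≡ 1
⟦b⟧+⟦not-b⟧≡1 true  = refl
⟦b⟧+⟦not-b⟧≡1 false = refl

==-refl : ∀ {n} (i : Fin n) → (i == i) ≡ true
==-refl i = dec-true (i ≟ i) refl

==-false : ∀ {n} {i j : Fin n} → i ≢ j → (i == j) ≡ false
==-false {i = i} {j} = dec-false (i ≟ j)

==-sym : ∀ {n} (i j : Fin n) → (i == j) ≡ (j == i)
==-sym i j with i ≟ j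
... | yes refl = sym (==-refl i)
... | no i≢j   = sym (==-false (λ j≡i → i≢j (sym j≡i)))

count-cong : ∀ {n} {f g : Fin n → Bool} → (∀ x → f x ≡ g x) → count f ≡ count g
count-cong {zero}  f≗g = refl
count-cong {suc n} f≗g rewrite f≗g zero = cong (_ +_) (count-cong (λ x → f≗g (suc x)))

count-false : ∀ n → count {n} (λ _ → false) ≡ 0
count-false zero    = refl
count-false (suc n) = count-false n

count-≡0 : ∀ {n} {f : Fin n → Bool} → (∀ x → f x ≡ false) → count f ≡ 0
count-≡0 {n} f≗false = trans (count-cong f≗false) (count-false n)

count-singleton : ∀ {n} (f : Fin n → Bool) (i : Fin n) →
                  (∀ j → j ≢ i → f j ≡ false) → count f ≡ ⟦ f i ⟧
count-singleton {suc n} f zero    off rewrite count-≡0 (λ x → off (suc x) λ ()) =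
  +-identityʳ ⟦ f zero ⟧
count-singleton {suc n} f (suc i) off rewrite off zero (λ ()) =
  count-singleton (λ x → f (suc x)) i (λ j j≢i → off (suc j) (λ eq → j≢i (Finₚ.suc-injective eq)))

count-+ : ∀ n {p} (f : Fin (n + p) → Bool) →
          count f ≡ count (λ a → f (a ↑ˡ p)) + count (λ b → f (n ↑ʳ b))
count-+ zero    f = refl
count-+ (suc n) f rewrite count-+ n (λ x → f (suc x)) = sym (+-assoc ⟦ f zero ⟧ _ _)

count-==-∧ : ∀ {n} (z : Fin n) (g : Fin n → Bool) → count (λ b → (b == z) ∧ g b) ≡ ⟦ g z ⟧
count-==-∧ z g = trans (count-singleton _ z (λ j j≢z → cong (_∧ g j) (==-false j≢z)))
                       (cong (λ b → ⟦ b ∧ g z ⟧) (==-refl z))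

count-∧-== : ∀ {n} (h : Fin n → Bool) (i : Fin n) → count (λ j → h j ∧ (j == i)) ≡ ⟦ h i ⟧
count-∧-== h i = trans
  (count-singleton _ i (λ j j≢i → trans (cong (h j ∧_) (==-false j≢i)) (∧-zeroʳ (h j))))
  (cong ⟦_⟧ (trans (cong (h i ∧_) (==-refl i)) (∧-identityʳ (h i))))

#inject₁ : ∀ {m} → Fin (suc m) → ℕ
#inject₁ {m} i = count (λ (j : Fin m) → inject₁ j == i)

isTop+#inject₁ : ∀ m (i : Fin (suc m)) → ⟦ isTop i ⟧ + #inject₁ i ≡ 1
isTop+#inject₁ zero    zero    = refl
isTop+#inject₁ (suc m) zero    = cong suc (count-false m)
isTop+#inject₁ (suc m) (suc i) = isTop+#inject₁ m i

#inject₁-top : ∀ m → #inject₁ (fromℕ m) ≡ 0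
#inject₁-top m = suc-injective
  (subst (λ b → ⟦ b ⟧ + #inject₁ (fromℕ m) ≡ 1) (==-refl (fromℕ m)) (isTop+#inject₁ m (fromℕ m)))

#inject₁-nonTop : ∀ {m} {i : Fin (suc m)} → i ≢ fromℕ m → #inject₁ i ≡ 1
#inject₁-nonTop {m} {i} i≢top =
  subst (λ b → ⟦ b ⟧ + #inject₁ i ≡ 1) (==-false i≢top) (isTop+#inject₁ m i)

module _ {n m : ℕ} where

  fromKind : Kind n m → Fin (n + NewSize m)
  fromKind (old a)  = a ↑ˡ NewSize m
  fromKind (uu i)   = n ↑ʳ (i ↑ˡ (m + m))
  fromKind (vv i)   = n ↑ʳ (suc m ↑ʳ (i ↑ˡ m))
  fromKind (vv' i)  = n ↑ʳ (suc m ↑ʳ (m ↑ʳ i))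

  classify-fromKind : ∀ k → classify n m (fromKind k) ≡ k
  classify-fromKind (old a)
    rewrite splitAt-↑ˡ n a (NewSize m) = refl
  classify-fromKind (uu i)
    rewrite splitAt-↑ʳ n (NewSize m) (i ↑ˡ (m + m)) | splitAt-↑ˡ (suc m) i (m + m) = refl
  classify-fromKind (vv i)
    rewrite splitAt-↑ʳ n (NewSize m) (suc m ↑ʳ (i ↑ˡ m)) | splitAt-↑ʳ (suc m) (m + m) (i ↑ˡ m)
          | splitAt-↑ˡ m i m = refl
  classify-fromKind (vv' i)
    rewrite splitAt-↑ʳ n (NewSize m) (suc m ↑ʳ (m ↑ʳ i)) | splitAt-↑ʳ (suc m) (m + m) (m ↑ʳ i)
          | splitAt-↑ʳ m m i = refl

  fromKind-classify : ∀ x → fromKind (classify n m x) ≡ x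
  fromKind-classify x with splitAt n x in e₁
  ... | inj₁ a = splitAt⁻¹-↑ˡ e₁
  ... | inj₂ y with splitAt (suc m) y in e₂
  ...   | inj₁ i = trans (cong (n ↑ʳ_) (splitAt⁻¹-↑ˡ e₂)) (splitAt⁻¹-↑ʳ e₁)
  ...   | inj₂ w with splitAt m w in e₃
  ...     | inj₁ i = trans (cong (λ w → n ↑ʳ (suc m ↑ʳ w)) (splitAt⁻¹-↑ˡ e₃))
                           (trans (cong (n ↑ʳ_) (splitAt⁻¹-↑ʳ e₂)) (splitAt⁻¹-↑ʳ e₁))
  ...     | inj₂ i = trans (cong (λ w → n ↑ʳ (suc m ↑ʳ w)) (splitAt⁻¹-↑ʳ e₃))
                           (trans (cong (n ↑ʳ_) (splitAt⁻¹-↑ʳ e₂)) (splitAt⁻¹-↑ʳ e₁))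

  fromKind-injective : ∀ {k l} → fromKind k ≡ fromKind l → k ≡ l
  fromKind-injective {k} {l} eq =
    trans (sym (classify-fromKind k)) (trans (cong (classify n m) eq) (classify-fromKind l))

  countKind : (Kind n m → Bool) → ℕ
  countKind p = count (λ a → p (old a))
              + (count (λ i → p (uu i)) + (count (λ i → p (vv i)) + count (λ i → p (vv' i))))

  count-byKind : (f : Fin (n + NewSize m) → Bool) (p : Kind n m → Bool) →
                 (∀ k → f (fromKind k) ≡ p k) → count f ≡ countKind p
  count-byKind f p f≗p =
    trans (count-+ n f)
      (cong₂ _+_ (count-cong (λ a → f≗p (old a)))
        (trans (count-+ (suc m) (λ y → f (n ↑ʳ y)))
          (cong₂ _+_ (count-cong (λ i → f≗p (uu i)))
            (trans (count-+ m (λ w → f (n ↑ʳ (suc m ↑ʳ w))))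
              (cong₂ _+_ (count-cong (λ i → f≗p (vv i))) (count-cong (λ i → f≗p (vv' i))))))))

  sameKind : Kind n m → Kind n m → Bool
  sameKind (old a) (old b) = a == b
  sameKind (uu i)  (uu j)  = i == j
  sameKind (vv i)  (vv j)  = i == j
  sameKind (vv' i) (vv' j) = i == j
  sameKind _       _       = false

  sameKind-refl : ∀ k → sameKind k k ≡ true
  sameKind-refl (old a) = ==-refl a
  sameKind-refl (uu i)  = ==-refl i
  sameKind-refl (vv i)  = ==-refl i
  sameKind-refl (vv' i) = ==-refl i

  sameKind-false : ∀ k l → k ≢ l → sameKind k l ≡ false
  sameKind-false (old a) (old b) k≢l = ==-false (λ a≡b → k≢l (cong old a≡b))
  sameKind-false (uu i)  (uu j)  k≢l = ==-false (λ i≡j → k≢l (cong uu i≡j))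
  sameKind-false (vv i)  (vv j)  k≢l = ==-false (λ i≡j → k≢l (cong vv i≡j))
  sameKind-false (vv' i) (vv' j) k≢l = ==-false (λ i≡j → k≢l (cong vv' i≡j))
  sameKind-false (old _) (uu _)  _ = refl
  sameKind-false (old _) (vv _)  _ = refl
  sameKind-false (old _) (vv' _) _ = refl
  sameKind-false (uu _)  (old _) _ = refl
  sameKind-false (uu _)  (vv _)  _ = refl
  sameKind-false (uu _)  (vv' _) _ = refl
  sameKind-false (vv _)  (old _) _ = refl
  sameKind-false (vv _)  (uu _)  _ = refl
  sameKind-false (vv _)  (vv' _) _ = refl
  sameKind-false (vv' _) (old _) _ = refl
  sameKind-false (vv' _) (uu _)  _ = refl
  sameKind-false (vv' _) (vv _)  _ = refl

  fromKind-== : ∀ k l → (fromKind k == fromKind l) ≡ sameKind k l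
  fromKind-== k l with fromKind k ≟ fromKind l
  ... | yes eq = sym (subst (λ l → sameKind k l ≡ true) (fromKind-injective eq) (sameKind-refl k))
  ... | no  ne = sym (sameKind-false k l (λ k≡l → ne (cong fromKind k≡l)))

x+y≡1⇒x+[x+[y+y]]≡2 : ∀ x y → x + y ≡ 1 → x + (x + (y + y)) ≡ 2
x+y≡1⇒x+[x+[y+y]]≡2 zero       _    refl = refl
x+y≡1⇒x+[x+[y+y]]≡2 (suc zero) zero refl = refl

module VertexAddition (m : ℕ) {n : ℕ} (A : Fin n → Fin n → Bool) (c : Fin n → Fin (suc m))
                      (z : Fin n) (cz : c z ≡ fromℕ m) where

  open ≡-Reasoning

  A′ : Fin (n + NewSize m) → Fin (n + NewSize m) → Bool
  A′ = addAdj m A z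

  c′ : Fin (n + NewSize m) → Fin (suc m)
  c′ = addColor m c

  kindNbColorCount : Kind n m → Fin (suc m) → ℕ
  kindNbColorCount k₀ i = countKind (λ k → (sameKind k₀ k ∨ kindAdj A z k₀ k) ∧ (kindColor c k == i))

  nbColorCount-fromKind : ∀ k₀ i → nbColorCount A′ c′ (fromKind k₀) i ≡ kindNbColorCount k₀ i
  nbColorCount-fromKind k₀ i = count-byKind _ _ pointwise
    where
    pointwise : ∀ k → (inN A′ (fromKind k₀) (fromKind k) ∧ (c′ (fromKind k) == i))
                    ≡ ((sameKind k₀ k ∨ kindAdj A z k₀ k) ∧ (kindColor c k == i))
    pointwise k
      rewrite fromKind-== k₀ k | classify-fromKind {n} {m} k₀ | classify-fromKind {n} {m} k = refl

  kindNbColorCount-old : ∀ a i → kindNbColorCount (old a) i ≡ nbColorCount A c a i + ⟦ a == z ⟧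
  kindNbColorCount-old a i = cong (nbColorCount A c a i +_) (begin
    count (λ j → (a == z) ∧ (j == i)) + (count {m} (λ _ → false) + count {m} (λ _ → false))
      ≡⟨ cong₂ _+_ (count-∧-== (λ _ → a == z) i) (cong₂ _+_ (count-false m) (count-false m)) ⟩
    ⟦ a == z ⟧ + 0
      ≡⟨ +-identityʳ ⟦ a == z ⟧ ⟩
    ⟦ a == z ⟧ ∎)

  uNeighbour : Fin (suc m) → Fin (suc m) → Bool
  uNeighbour t j = (t == j) ∨ kindAdj A z (uu t) (uu j)

  uvCount : Fin (suc m) → Fin (suc m) → ℕ
  uvCount t i = count (λ (j : Fin m) → isTop t ∧ (inject₁ j == i))

  kindNbColorCount-uu-expand : ∀ t i →
    kindNbColorCount (uu t) i ≡ ⟦ isTop i ⟧ + (⟦ uNeighbour t i ⟧ + (uvCount t i + uvCount t i))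
  kindNbColorCount-uu-expand t i =
    cong₂ _+_ (begin
        count (λ b → (b == z) ∧ (c b == i)) ≡⟨ count-==-∧ z (λ b → c b == i) ⟩
        ⟦ c z == i ⟧                         ≡⟨ cong (λ x → ⟦ x == i ⟧) cz ⟩
        ⟦ fromℕ m == i ⟧                     ≡⟨ cong ⟦_⟧ (==-sym (fromℕ m) i) ⟩
        ⟦ isTop i ⟧                          ∎)
      (cong (_+ (uvCount t i + uvCount t i)) (count-∧-== (uNeighbour t) i))

  uNeighbour-top : ∀ i → uNeighbour (fromℕ m) i ≡ isTop i
  uNeighbour-top i rewrite ==-refl (fromℕ m) =
    trans (cong (fromℕ m == i ∨_) (∧-zeroʳ (not (fromℕ m == i))))
          (trans (∨-identityʳ (fromℕ m == i)) (==-sym (fromℕ m) i))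

  uNeighbour-nonTop : ∀ {t} i → isTop t ≡ false → uNeighbour t i ≡ not (isTop i)
  uNeighbour-nonTop {t} i t-nonTop with t ≟ i
  ... | yes refl = cong not (sym t-nonTop)
  ... | no  _    rewrite t-nonTop = refl

  uvCount-top : ∀ i → uvCount (fromℕ m) i ≡ #inject₁ i
  uvCount-top i = count-cong (λ j → cong (_∧ (inject₁ j == i)) (==-refl (fromℕ m)))

  uvCount-nonTop : ∀ {t} i → isTop t ≡ false → uvCount t i ≡ 0
  uvCount-nonTop i t-nonTop = count-≡0 (λ j → cong (_∧ (inject₁ j == i)) t-nonTop)

  kindNbColorCount-uu : ∀ t i → kindNbColorCount (uu t) i ≡ (if isTop t then 2 else 1)
  kindNbColorCount-uu t i = byTopness (t ≟ fromℕ m)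
    where
    byTopness : Dec (t ≡ fromℕ m) → kindNbColorCount (uu t) i ≡ (if isTop t then 2 else 1)
    byTopness (yes refl) = begin
        kindNbColorCount (uu (fromℕ m)) i
          ≡⟨ kindNbColorCount-uu-expand (fromℕ m) i ⟩
        ⟦ isTop i ⟧ + (⟦ uNeighbour (fromℕ m) i ⟧ + (uvCount (fromℕ m) i + uvCount (fromℕ m) i))
          ≡⟨ cong₂ (λ b x → ⟦ isTop i ⟧ + (⟦ b ⟧ + (x + x))) (uNeighbour-top i) (uvCount-top i) ⟩
        ⟦ isTop i ⟧ + (⟦ isTop i ⟧ + (#inject₁ i + #inject₁ i))
          ≡⟨ x+y≡1⇒x+[x+[y+y]]≡2 ⟦ isTop i ⟧ (#inject₁ i) (isTop+#inject₁ m i) ⟩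
        2
          ≡⟨ cong (λ b → if b then 2 else 1) (==-refl (fromℕ m)) ⟨
        (if isTop (fromℕ m) then 2 else 1) ∎
    byTopness (no t≢top) = let t-nonTop = ==-false t≢top in begin
        kindNbColorCount (uu t) i
          ≡⟨ kindNbColorCount-uu-expand t i ⟩
        ⟦ isTop i ⟧ + (⟦ uNeighbour t i ⟧ + (uvCount t i + uvCount t i))
          ≡⟨ cong₂ (λ b x → ⟦ isTop i ⟧ + (⟦ b ⟧ + (x + x)))
                   (uNeighbour-nonTop {t} i t-nonTop) (uvCount-nonTop {t} i t-nonTop) ⟩
        ⟦ isTop i ⟧ + (⟦ not (isTop i) ⟧ + 0)
          ≡⟨ cong (⟦ isTop i ⟧ +_) (+-identityʳ _) ⟩
        ⟦ isTop i ⟧ + ⟦ not (isTop i) ⟧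
          ≡⟨ ⟦b⟧+⟦not-b⟧≡1 (isTop i) ⟩
        1
          ≡⟨ cong (λ b → if b then 2 else 1) t-nonTop ⟨
        (if isTop t then 2 else 1) ∎

  vClique : ∀ t i → count (λ (j : Fin m) → ((t == j) ∨ not (t == j)) ∧ (inject₁ j == i)) ≡ #inject₁ i
  vClique t i = count-cong (λ j → cong (_∧ (inject₁ j == i)) (∨-inverseʳ (t == j)))

  kindNbColorCount-vv : ∀ t i → kindNbColorCount (vv t) i ≡ 1
  kindNbColorCount-vv t i = begin
    kindNbColorCount (vv t) i
      ≡⟨ cong₂ _+_ (count-false n)
           (cong₂ _+_ (count-∧-== isTop i) (cong₂ _+_ (vClique t i) (count-false m))) ⟩
    ⟦ isTop i ⟧ + (#inject₁ i + 0)
      ≡⟨ cong (⟦ isTop i ⟧ +_) (+-identityʳ (#inject₁ i)) ⟩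
    ⟦ isTop i ⟧ + #inject₁ i
      ≡⟨ isTop+#inject₁ m i ⟩
    1 ∎

  kindNbColorCount-vv' : ∀ t i → kindNbColorCount (vv' t) i ≡ 1
  kindNbColorCount-vv' t i = begin
    kindNbColorCount (vv' t) i
      ≡⟨ cong₂ _+_ (count-false n)
           (cong₂ _+_ (count-∧-== isTop i) (cong₂ _+_ (count-false m) (vClique t i))) ⟩
    ⟦ isTop i ⟧ + #inject₁ i
      ≡⟨ isTop+#inject₁ m i ⟩
    1 ∎

  kindNbColorCount-balanced : IsCNBalanced A c →
                              ∀ k₀ i j → kindNbColorCount k₀ i ≡ kindNbColorCount k₀ j
  kindNbColorCount-balanced balanced (old a) i j = begin
    kindNbColorCount (old a) i          ≡⟨ kindNbColorCount-old a i ⟩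
    nbColorCount A c a i + ⟦ a == z ⟧   ≡⟨ cong (_+ ⟦ a == z ⟧) (balanced a i j) ⟩
    nbColorCount A c a j + ⟦ a == z ⟧   ≡⟨ kindNbColorCount-old a j ⟨
    kindNbColorCount (old a) j          ∎
  kindNbColorCount-balanced _ (uu t)  i j = trans (kindNbColorCount-uu t i) (sym (kindNbColorCount-uu t j))
  kindNbColorCount-balanced _ (vv t)  i j = trans (kindNbColorCount-vv t i) (sym (kindNbColorCount-vv t j))
  kindNbColorCount-balanced _ (vv' t) i j = trans (kindNbColorCount-vv' t i) (sym (kindNbColorCount-vv' t j))

  addColor-balanced : IsCNBalanced A c → IsCNBalanced A′ c′
  addColor-balanced balanced x i j =
    subst (λ x → nbColorCount A′ c′ x i ≡ nbColorCount A′ c′ x j) (fromKind-classify x) (begin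
      nbColorCount A′ c′ (fromKind k) i  ≡⟨ nbColorCount-fromKind k i ⟩
      kindNbColorCount k i               ≡⟨ kindNbColorCount-balanced balanced k i j ⟩
      kindNbColorCount k j               ≡⟨ nbColorCount-fromKind k j ⟨
      nbColorCount A′ c′ (fromKind k) j  ∎)
    where k = classify n m x

  colorCount-addColor : ∀ i → colorCount c′ i ≡ colorCount c i + suc (#inject₁ i + #inject₁ i)
  colorCount-addColor i =
    trans (count-byKind _ (λ k → kindColor c k == i)
                        (λ k → cong (λ k → kindColor c k == i) (classify-fromKind k)))
          (cong (λ u → colorCount c i + (u + (#inject₁ i + #inject₁ i))) (count-∧-== (λ _ → true) i))

proposition2p13 : ∀ (m : ℕ) → 1 ≤ m → ∀ {n} (G : Graph n) (c : Fin n → Fin (suc m))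
    → IsCNBalanced (adj G) c → (z : Fin n) → c z ≡ fromℕ m
    → IsCNBalanced (addAdj m (adj G) z) (addColor m c)
    × colorCount (addColor m c) (fromℕ m) ≡ colorCount c (fromℕ m) + 1
    × (∀ (i : Fin (suc m)) → i ≢ fromℕ m → colorCount (addColor m c) i ≡ colorCount c i + 3)
proposition2p13 m _ G c balanced z cz =
    addColor-balanced balanced
  , trans (colorCount-addColor (fromℕ m))
          (cong (λ x → colorCount c (fromℕ m) + suc (x + x)) (#inject₁-top m))
  , λ i i≢top → trans (colorCount-addColor i)
                      (cong (λ x → colorCount c i + suc (x + x)) (#inject₁-nonTop i≢top))
  where open VertexAddition m (adj G) c z cz
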